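{- For every integer $\ell\ge 2$, $\mathcal{C}_{\ell}\subsetneq \mathcal{C}^{is}_{\ell+1}$, where $\mathcal{C}_\ell$ is the class of chordal graphs of leafage at most $\ell$ and $\mathcal{C}^{is}_{\ell+1}$ is the class of chordal graphs that do not contain $H_{\ell+1}$ as an induced subgraph.
   Context: A graph is chordal if it has no induced cycle of length at least four. The leafage of a chordal graph $G$ is the minimum number of leaves of a tree $T$ such that $G$ is the intersection graph of a family of subtrees of $T$. For $m\ge 3$, $H_m$ is the split graph on $2m$ vertices with a clique $C$ of size $m$ and an independent set $I$ of size $m$, where the edges between $C$ and $I$ form a perfect matching. -}

module Defs where

open import Data.Nat using (ℕ; zero; suc; _+_; _≟_)
open import Data.Bool using (Bool; true; false; _∨_; _∧_; if_then_else_)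
open import Data.Fin using (Fin; toℕ; splitAt)
open import Data.Fin.Properties using () renaming (_≟_ to _≟ᶠ_)
open import Data.List using (List; map)
open import Data.Nat.ListAction using (sum)
open import Data.List.Base using (allFin)
open import Data.Sum using (_⊎_; inj₁; inj₂)
open import Data.Product using (Σ; _×_; ∃)
open import Data.Unit using (⊤)
open import Relation.Nullary using (¬_; does)
open import Relation.Binary.PropositionalEquality using (_≡_; _≢_)
open import Function using (Injective)
open import Function.Bundles using (_⇔_)

record Graph (n : ℕ) : Set where
  field
    adj    : Fin n → Fin n → Bool
    sym    : ∀ i j → adj i j ≡ adj j i
    irrefl : ∀ i → adj i i ≡ false
open Graph public

Embeds : ∀ {m n} → (Fin m → Fin m → Bool) → Graph n → Set
Embeds {m} A G =
  Σ (Fin m → Fin _) λ f → Injective _≡_ _≡_ f ×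
    (∀ i j → i ≢ j → A i j ≡ adj G (f i) (f j))

cycAdj : (k : ℕ) → Fin k → Fin k → Bool
cycAdj k i j =
  does (suc (toℕ i) ≟ toℕ j) ∨ does (suc (toℕ j) ≟ toℕ i) ∨
  (does (toℕ i ≟ 0) ∧ does (suc (toℕ j) ≟ k)) ∨
  (does (toℕ j ≟ 0) ∧ does (suc (toℕ i) ≟ k))

Chordal : ∀ {n} → Graph n → Set
Chordal G = ∀ r → ¬ Embeds (cycAdj (4 + r)) G

-- H_m on Fin (m + m): first m vertices form the clique C, last m the
-- independent set I, and clique vertex a is adjacent to independent vertex a.
hAdj : (m : ℕ) → Fin (m + m) → Fin (m + m) → Bool
hAdj m x y with splitAt m x | splitAt m y
... | inj₁ a | inj₁ b = true
... | inj₁ a | inj₂ b = does (a ≟ᶠ b)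
... | inj₂ a | inj₁ b = does (a ≟ᶠ b)
... | inj₂ a | inj₂ b = false

data Walk {n} (G : Graph n) (S : Fin n → Set) : Fin n → Fin n → Set where
  here : ∀ {u} → S u → Walk G S u u
  step : ∀ {u v w} → S u → adj G u v ≡ true → Walk G S v w → Walk G S u w

ConnectedOn : ∀ {n} → Graph n → (Fin n → Set) → Set
ConnectedOn G S = ∀ u v → S u → S v → Walk G S u v

HasCycle : ∀ {n} → Graph n → Set
HasCycle G = Σ ℕ λ r → Σ (Fin (3 + r) → Fin _) λ c → Injective _≡_ _≡_ c ×
  (∀ i j → cycAdj (3 + r) i j ≡ true → adj G (c i) (c j) ≡ true)

IsTree : ∀ {t} → Graph t → Set
IsTree T = ConnectedOn T (λ _ → ⊤) × ¬ HasCycle T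

degree : ∀ {t} → Graph t → Fin t → ℕ
degree {t} T x = sum (map (λ y → if adj T x y then 1 else 0) (allFin t))

leafCount : ∀ {t} → Graph t → ℕ
leafCount {t} T = sum (map (λ x → if does (degree T x ≟ 1) then 1 else 0) (allFin t))

IsSubtree : ∀ {t} → Graph t → (Fin t → Bool) → Set
IsSubtree T S = (∃ λ x → S x ≡ true) × ConnectedOn T (λ x → S x ≡ true)

TreeRep : ∀ {n t} → Graph n → Graph t → Set
TreeRep {n} {t} G T =
  Σ (Fin n → Fin t → Bool) λ S →
    (∀ v → IsSubtree T (S v)) ×
    (∀ u v → u ≢ v → (adj G u v ≡ true ⇔ ∃ λ x → (S u x ≡ true × S v x ≡ true)))

LeafageAtMost : ∀ {n} → ℕ → Graph n → Set
LeafageAtMost {n} ℓ G =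
  Σ ℕ λ t → Σ (Graph (suc t)) λ T → IsTree T × TreeRep G T × (leafCount T Data.Nat.≤ ℓ)

{-# OPTIONS --safe #-}
-- Call k vertices an asteroidal set when, for each of them, all the others lie in one component of
-- the graph minus its closed neighbourhood. In a tree representation the subtree of such a vertex
-- is cut off from the connected union of the subtrees of that component; some leaf of the host tree
-- lies beyond the cut, and different vertices get different leaves, so the host tree has at least
-- k leaves. The independent vertices of H_{ℓ+1} form an asteroidal set, so a graph of leafage at
-- most ℓ does not contain H_{ℓ+1}. Conversely the spider with ℓ+1 legs of length two is a tree,
-- hence chordal, and triangle-free, hence H_{ℓ+1}-free, while its ℓ+1 feet form an asteroidal set.
module Submission where

open import Defs renaming (sym to adj-sym)
open import Data.Bool using (Bool; true; false; _∨_; _∧_; if_then_else_; T; not)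
open import Data.Bool.Properties using (not-¬) renaming (_≟_ to _≟ᵇ_)
open import Data.Empty using (⊥; ⊥-elim)
open import Data.Fin using (Fin; zero; suc; toℕ; fromℕ; _↑ˡ_; _↑ʳ_; splitAt; join)
open import Data.Fin.Properties
  using (any?; injective⇒≤; toℕ-injective; toℕ-fromℕ; sequence;
         splitAt-↑ˡ; splitAt-↑ʳ; join-splitAt; ↑ˡ-injective; ↑ʳ-injective)
  renaming (_≟_ to _≟ᶠ_)
open import Data.List using (List; []; _∷_; _++_; [_]; length; lookup; map; allFin; filter)
open import Data.List.Properties using (++-assoc)
open import Data.List.Relation.Unary.All as All using (All; []; _∷_)
open import Data.List.Relation.Unary.All.Properties using (¬Any⇒All¬; ++⁻ˡ)
open import Data.List.Relation.Unary.Any using (here; there; index)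
open import Data.List.Relation.Unary.Any.Properties using (lookup-index)
open import Data.List.Relation.Unary.AllPairs using ([]; _∷_)
open import Data.List.Relation.Unary.Unique.Propositional using (Unique)
open import Data.List.Relation.Unary.Unique.Propositional.Properties using (allFin⁺; ++⁺)
open import Data.List.Membership.Propositional using (_∈_)
open import Data.List.Membership.Propositional.Properties using (∈-lookup; ∈-∃++; ∈-filter⁺; ∈-allFin)
open import Data.Nat using (ℕ; zero; suc; _+_; _≤_; _<_; z≤n; s≤s; _≟_)
import Data.Nat.Properties as ℕ
open import Data.Nat.ListAction using (sum)
open import Data.Product using (Σ; _×_; _,_; proj₁; proj₂; ∃)
open import Data.Sum using (_⊎_; inj₁; inj₂; [_,_]′)
open import Data.Unit using (⊤; tt)
open import Effect.Monad using (RawMonad)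
open import Function using (_∘_; Injective)
open import Function.Bundles using (Equivalence)
open import Relation.Nullary using (¬_; yes; no; does)
open import Relation.Nullary.Decidable using (_×-dec_; ¬?; T?; dec-true; dec-false; decidable-stable)
open import Relation.Nullary.Negation using (¬¬-Monad)
open import Relation.Binary.PropositionalEquality using (_≡_; _≢_; refl; sym; trans; cong; subst; subst₂)

∨-true : ∀ {x y} → (x ∨ y) ≡ true → x ≡ true ⊎ y ≡ true
∨-true {true}  _ = inj₁ refl
∨-true {false} h = inj₂ h

∧-true : ∀ {x y} → (x ∧ y) ≡ true → x ≡ true × y ≡ true
∧-true {true} h = refl , h

≟-true : ∀ {a b : ℕ} → does (a ≟ b) ≡ true → a ≡ b
≟-true {a} {b} h = ℕ.≡ᵇ⇒≡ a b (subst T (sym h) tt)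

cycAdj-true : ∀ k (i j : Fin k) → cycAdj k i j ≡ true →
  suc (toℕ i) ≡ toℕ j ⊎ suc (toℕ j) ≡ toℕ i ⊎
  (toℕ i ≡ 0 × suc (toℕ j) ≡ k) ⊎ (toℕ j ≡ 0 × suc (toℕ i) ≡ k)
cycAdj-true k i j h with ∨-true h
... | inj₁ i→j = inj₁ (≟-true i→j)
... | inj₂ h₁ with ∨-true h₁
...   | inj₁ j→i = inj₂ (inj₁ (≟-true j→i))
...   | inj₂ h₂ with ∨-true h₂
...     | inj₁ wrap = let i0 , jk = ∧-true wrap in inj₂ (inj₂ (inj₁ (≟-true i0 , ≟-true jk)))
...     | inj₂ wrap = let j0 , ik = ∧-true wrap in inj₂ (inj₂ (inj₂ (≟-true j0 , ≟-true ik)))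

module _ {n : ℕ} (G : Graph n) where

  Edge : Fin n → Fin n → Set
  Edge u v = adj G u v ≡ true

  edge-sym : ∀ {u v} → Edge u v → Edge v u
  edge-sym {u} {v} e = trans (adj-sym G v u) e

  edge-irrefl : ∀ {u v} → Edge u v → u ≢ v
  edge-irrefl {u} e refl with trans (sym (irrefl G u)) e
  ... | ()

module _ {n : ℕ} {G : Graph n} where

  walk-source : ∀ {S u v} → Walk G S u v → S u
  walk-source (here s)     = s
  walk-source (step s _ _) = s

  _◅◅_ : ∀ {S u v w} → Walk G S u v → Walk G S v w → Walk G S u w
  here _     ◅◅ q = q
  step s e p ◅◅ q = step s e (p ◅◅ q)

  walk-snoc : ∀ {S u v w} → Walk G S u v → Edge G v w → S w → Walk G S u w
  walk-snoc (here s)     e sw = step s e (here sw)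
  walk-snoc (step s e p) f sw = step s e (walk-snoc p f sw)

  reverse-walk : ∀ {S u v} → Walk G S u v → Walk G S v u
  reverse-walk (here s)     = here s
  reverse-walk (step s e p) = walk-snoc (reverse-walk p) (edge-sym G e) s

  map-walk : ∀ {S S′ : Fin n → Set} {u v} → (∀ {x} → S x → S′ x) → Walk G S u v → Walk G S′ u v
  map-walk f (here s)     = here (f s)
  map-walk f (step s e p) = step (f s) e (map-walk f p)

module Paths {n : ℕ} (G : Graph n) where
  open import Data.List.Membership.DecPropositional (_≟ᶠ_ {n}) using (_∈?_)

  Chain : Fin n → List (Fin n) → Set
  Chain x []       = ⊤
  Chain x (y ∷ ys) = Edge G x y × Chain y ys

  end : Fin n → List (Fin n) → Fin n
  end x []       = x
  end x (y ∷ ys) = end y ys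

  record Path (S : Fin n → Set) (u v : Fin n) : Set where
    constructor path
    field
      rest   : List (Fin n)
      chain  : Chain u rest
      unique : Unique (u ∷ rest)
      inside : All S (u ∷ rest)
      ends   : end u rest ≡ v

  suffix-path : ∀ {S x z} ys → z ∈ x ∷ ys → Chain x ys → Unique (x ∷ ys) → All S (x ∷ ys) →
                Path S z (end x ys)
  suffix-path ys       (here refl) c u s = path ys c u s refl
  suffix-path (y ∷ ys) (there z∈)  (_ , c) (_ ∷ u) (_ ∷ s) = suffix-path ys z∈ c u s

  walk⇒path : ∀ {S u v} → Walk G S u v → Path S u v
  walk⇒path (here s) = path [] tt ([] ∷ []) (s ∷ []) refl
  walk⇒path {S} {u} (step {v = x} s e w) with walk⇒path w
  ... | path ys c un al ends with u ∈? x ∷ ys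
  ...   | yes u∈ = subst (Path S u) ends (suffix-path ys u∈ c un al)
  ...   | no u∉  = path (x ∷ ys) (e , c) (¬Any⇒All¬ _ u∉ ∷ un) (s ∷ al) ends

  chain-++ : ∀ x ys z zs → Chain x ys → Edge G (end x ys) z → Chain z zs → Chain x (ys ++ z ∷ zs)
  chain-++ x []       z zs _       e c = e , c
  chain-++ x (y ∷ ys) z zs (f , d) e c = f , chain-++ y ys z zs d e c

  chain-prefix : ∀ x ys zs → Chain x (ys ++ zs) → Chain x ys
  chain-prefix x []       zs _       = tt
  chain-prefix x (y ∷ ys) zs (e , c) = e , chain-prefix y ys zs c

  end-++ : ∀ x ys z zs → end x (ys ++ z ∷ zs) ≡ end z zs
  end-++ x []       z zs = refl
  end-++ x (y ∷ ys) z zs = end-++ y ys z zs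

  unique-prefix : ∀ (xs : List (Fin n)) {ys} → Unique (xs ++ ys) → Unique xs
  unique-prefix []       _       = []
  unique-prefix (x ∷ xs) (a ∷ u) = ++⁻ˡ xs a ∷ unique-prefix xs u

  lookup-injective : ∀ (xs : List (Fin n)) → Unique xs → ∀ i j → lookup xs i ≡ lookup xs j → i ≡ j
  lookup-injective (x ∷ xs) (x∉ ∷ u) zero    zero    _  = refl
  lookup-injective (x ∷ xs) (x∉ ∷ u) zero    (suc j) eq = ⊥-elim (All.lookup x∉ (∈-lookup j) eq)
  lookup-injective (x ∷ xs) (x∉ ∷ u) (suc i) zero    eq = ⊥-elim (All.lookup x∉ (∈-lookup i) (sym eq))
  lookup-injective (x ∷ xs) (x∉ ∷ u) (suc i) (suc j) eq = cong suc (lookup-injective xs u i j eq)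

  unique-length : ∀ (xs : List (Fin n)) → Unique xs → length xs ≤ n
  unique-length xs u = injective⇒≤ (lookup-injective xs u _ _)

  chain-lookup : ∀ x ys → Chain x ys → ∀ (i j : Fin (length (x ∷ ys))) → suc (toℕ i) ≡ toℕ j →
                 Edge G (lookup (x ∷ ys) i) (lookup (x ∷ ys) j)
  chain-lookup x (y ∷ ys) (e , c) zero    (suc zero) _ = e
  chain-lookup x (y ∷ ys) (e , c) (suc i) (suc j)    h = chain-lookup y ys c i j (ℕ.suc-injective h)

  lookup-end : ∀ x ys (j : Fin (length (x ∷ ys))) → suc (toℕ j) ≡ length (x ∷ ys) →
               lookup (x ∷ ys) j ≡ end x ys
  lookup-end x []       zero    _ = refl
  lookup-end x (y ∷ ys) (suc j) h = lookup-end y ys j (ℕ.suc-injective h)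

  closed-chain⇒cycle : ∀ x ys → Chain x ys → Unique (x ∷ ys) → 2 ≤ length ys → Edge G (end x ys) x →
                       HasCycle G
  closed-chain⇒cycle x (_ ∷ []) _ _ (s≤s ()) _
  closed-chain⇒cycle x (y₁ ∷ y₂ ∷ zs) c u _ closing =
    length zs , lookup xs , (λ {i} {j} → lookup-injective xs u i j) , edge
    where
    xs = x ∷ y₁ ∷ y₂ ∷ zs
    first : ∀ i → toℕ i ≡ 0 → lookup xs i ≡ x
    first i h = cong (lookup xs) (toℕ-injective {j = zero} h)
    edge : ∀ i j → cycAdj (length xs) i j ≡ true → Edge G (lookup xs i) (lookup xs j)
    edge i j h with cycAdj-true _ i j h
    ... | inj₁ i→j                  = chain-lookup x _ c i j i→j
    ... | inj₂ (inj₁ j→i)           = edge-sym G (chain-lookup x _ c j i j→i)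
    ... | inj₂ (inj₂ (inj₁ (i0 , jk))) =
      subst₂ (Edge G) (sym (first i i0)) (sym (lookup-end x _ j jk)) (edge-sym G closing)
    ... | inj₂ (inj₂ (inj₂ (j0 , ik))) =
      subst₂ (Edge G) (sym (lookup-end x _ i ik)) (sym (first j j0)) closing

module _ {n : ℕ} where

  count : (Fin n → Bool) → List (Fin n) → ℕ
  count b xs = sum (map (λ y → if b y then 1 else 0) xs)

  count-absent : ∀ (b : Fin n → Bool) xs → All (λ x → b x ≡ false) xs → count b xs ≡ 0
  count-absent b []       []         = refl
  count-absent b (x ∷ xs) (bx ∷ bxs) rewrite bx = count-absent b xs bxs

  count-single : ∀ (b : Fin n → Bool) {y} xs → Unique xs → y ∈ xs → b y ≡ true →
                 (∀ {z} → b z ≡ true → z ≡ y) → count b xs ≡ 1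
  count-single b {y} (y ∷ xs) (y∉ ∷ _) (here refl) by only rewrite by =
    cong suc (count-absent b xs (All.map (λ y≢z → false-unless (y≢z ∘ sym)) y∉))
    where
    false-unless : ∀ {z} → z ≢ y → b z ≡ false
    false-unless {z} z≢y with b z in bz
    ... | true  = ⊥-elim (z≢y (only bz))
    ... | false = refl
  count-single b (x ∷ xs) (x∉ ∷ u) (there y∈) by only with b x in bx
  ... | true  = ⊥-elim (All.lookup x∉ y∈ (only bx))
  ... | false = count-single b xs u y∈ by only

  count≡length-filter : ∀ (b : Fin n → Bool) xs → count b xs ≡ length (filter (T? ∘ b) xs)
  count≡length-filter b []       = refl
  count≡length-filter b (x ∷ xs) with b x
  ... | true  = cong suc (count≡length-filter b xs)
  ... | false = count≡length-filter b xs

  count-injection : ∀ (b : Fin n → Bool) {k} (f : Fin k → Fin n) → Injective _≡_ _≡_ f →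
                    (∀ a → b (f a) ≡ true) → k ≤ count b (allFin n)
  count-injection b f f-inj bf rewrite count≡length-filter b (allFin n) =
    injective⇒≤ {f = index ∘ member} λ {a} {a′} eq →
      f-inj (trans (lookup-index (member a))
                   (trans (cong (lookup selected) eq) (sym (lookup-index (member a′)))))
    where
    selected = filter (T? ∘ b) (allFin n)
    member : ∀ a → f a ∈ selected
    member a = ∈-filter⁺ (T? ∘ b) (∈-allFin (f a)) (subst T (sym (bf a)) tt)

degree≡1 : ∀ {t} (T : Graph t) {p y} → Edge T p y → (∀ {z} → Edge T p z → z ≡ y) → degree T p ≡ 1
degree≡1 {t} T {p} e only = count-single (adj T p) (allFin t) (allFin⁺ t) (∈-allFin _) e only

leaves-injection : ∀ {t k} (T : Graph t) (f : Fin k → Fin t) → Injective _≡_ _≡_ f →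
                   (∀ a → degree T (f a) ≡ 1) → k ≤ leafCount T
leaves-injection T f f-inj leaf = count-injection _ f f-inj (λ a → dec-true (_ ≟ 1) (leaf a))

module Acyclic {n : ℕ} (G : Graph n) (acyclic : ¬ HasCycle G) where
  open Paths G
  open import Data.List.Membership.DecPropositional (_≟ᶠ_ {n}) using (_∈?_)

  no-chord : ∀ p q qs {z} → Chain p (q ∷ qs) → Unique (p ∷ q ∷ qs) → z ∈ qs → Edge G p z → ⊥
  no-chord p q qs {z} c u z∈ pz with ∈-∃++ z∈
  ... | pre , post , refl = acyclic (closed-chain⇒cycle p (q ∷ pre ++ [ z ])
          (chain-prefix p (q ∷ pre ++ [ z ]) post (subst (Chain p) (sym (++-assoc (q ∷ pre) [ z ] post)) c))
          (unique-prefix (p ∷ q ∷ pre ++ [ z ]) (subst Unique (sym (++-assoc (p ∷ q ∷ pre) [ z ] post)) u))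
          (long pre)
          (subst (λ x → Edge G x p) (sym (end-++ q pre z [])) (edge-sym G pz)))
    where
    long : ∀ pre → 2 ≤ length (q ∷ pre ++ [ z ])
    long []      = s≤s (s≤s z≤n)
    long (_ ∷ _) = s≤s (s≤s z≤n)

  no-two-attachments : ∀ {C : Fin n → Set} {u w} p ps → Chain p ps → Unique (p ∷ ps) →
                       All (¬_ ∘ C) (p ∷ ps) → Walk G C w u → Edge G (end p ps) w → Edge G p u → ps ≢ [] ⊎ u ≢ w → ⊥
  no-two-attachments {C} {u} {w} p ps c un out wu e pu nontrivial with walk⇒path wu
  ... | path qs c′ un′ in′ ends = acyclic (closed-chain⇒cycle p (ps ++ w ∷ qs)
          (chain-++ p ps w qs c e c′)
          (++⁺ un un′ λ (x∈ , x∈′) → All.lookup out x∈ (All.lookup in′ x∈′))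
          (long ps qs nontrivial ends)
          (subst (λ x → Edge G x p) (sym (trans (end-++ p ps w qs) ends)) (edge-sym G pu)))
    where
    long : ∀ ps qs → ps ≢ [] ⊎ u ≢ w → end w qs ≡ u → 2 ≤ length (ps ++ w ∷ qs)
    long []          []      (inj₁ ps≢[]) _    = ⊥-elim (ps≢[] refl)
    long []          []      (inj₂ u≢w)   ends = ⊥-elim (u≢w (sym ends))
    long []          (_ ∷ _) _            _    = s≤s (s≤s z≤n)
    long (_ ∷ [])    _       _            _    = s≤s (s≤s z≤n)
    long (_ ∷ _ ∷ _) _       _            _    = s≤s (s≤s z≤n)

  dead-end-leaf : ∀ {C : Fin n → Set} {w} p ps → Chain p ps → Unique (p ∷ ps) → All (¬_ ∘ C) (p ∷ ps) →
                  C w → Edge G (end p ps) w → (∀ {z} → Edge G p z → z ∈ p ∷ ps ⊎ z ≡ w) → degree G p ≡ 1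
  dead-end-leaf {w = w} p [] c un out w∈C e neighbour = degree≡1 G e only
    where
    only : ∀ {z} → Edge G p z → z ≡ w
    only pz with neighbour pz
    ... | inj₁ (here refl) = ⊥-elim (edge-irrefl G pz refl)
    ... | inj₂ z≡w         = z≡w
  dead-end-leaf p (q ∷ qs) c un out w∈C e neighbour = degree≡1 G (proj₁ c) only
    where
    only : ∀ {z} → Edge G p z → z ≡ q
    only pz with neighbour pz
    ... | inj₁ (here refl)         = ⊥-elim (edge-irrefl G pz refl)
    ... | inj₁ (there (here z≡q))  = z≡q
    ... | inj₁ (there (there z∈)) = ⊥-elim (no-chord p q qs c un z∈ pz)
    ... | inj₂ refl = ⊥-elim (no-two-attachments p (q ∷ qs) c un out (here w∈C) e pz (inj₁ λ ()))

  -- Grow a simple path from g away from C. It cannot re-enter C, as that would close a cycle through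
  -- the edge g w and a path inside C, so it ends at a leaf.
  leaf-outside : ∀ {C : Fin n → Set} → ConnectedOn G C → ∀ {g w} → ¬ C g → C w → Edge G g w →
                 ∃ λ v → degree G v ≡ 1 × ¬ C v
  leaf-outside {C} connected {g} {w} g∉C w∈C gw = grow n g [] tt ([] ∷ []) (g∉C ∷ []) gw (ℕ.n<1+n n)
    where
    grow : ∀ fuel p ps → Chain p ps → Unique (p ∷ ps) → All (¬_ ∘ C) (p ∷ ps) → Edge G (end p ps) w →
           n < length (p ∷ ps) + fuel → ∃ λ v → degree G v ≡ 1 × ¬ C v
    grow zero p ps c un out e long =
      ⊥-elim (ℕ.<⇒≱ (subst (n <_) (ℕ.+-identityʳ _) long) (unique-length (p ∷ ps) un))
    grow (suc fuel) p ps c un out e long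
      with any? (λ y → (adj G p y ≟ᵇ true) ×-dec ¬? (y ∈? p ∷ ps) ×-dec ¬? (y ≟ᶠ w))
    ... | yes (y , py , y∉ , y≢w) =
      grow fuel y (p ∷ ps) (edge-sym G py , c) (¬Any⇒All¬ _ y∉ ∷ un) (y∉C ∷ out) e
        (subst (n <_) (ℕ.+-suc (length (p ∷ ps)) fuel) long)
      where
      y∉C : ¬ C y
      y∉C y∈C = no-two-attachments p ps c un out (connected w y w∈C y∈C) e py (inj₂ y≢w)
    ... | no stuck = p , dead-end-leaf p ps c un out w∈C e visited-or-w , All.head out
      where
      visited-or-w : ∀ {z} → Edge G p z → z ∈ p ∷ ps ⊎ z ≡ w
      visited-or-w {z} pz with z ∈? p ∷ ps | z ≟ᶠ w
      ... | yes z∈ | _       = inj₁ z∈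
      ... | no _   | yes z≡w = inj₂ z≡w
      ... | no z∉  | no z≢w  = ⊥-elim (stuck (z , pz , z∉ , z≢w))

module PrivateLeaves {N : ℕ} (T : Graph N) (tree : IsTree T) {k : ℕ}
  (X : Fin k → Fin N → Bool) (W : Fin k → Fin N → Set)
  (X-inhabited : ∀ a → ∃ λ x → X a x ≡ true)
  (W-inhabited : ∀ a → ∃ (W a))
  (W-connected : ∀ a → ConnectedOn T (W a))
  (W-avoids-X : ∀ a x → W a x → X a x ≡ false)
  (W-covers-X : ∀ a b → a ≢ b → ∀ x → X b x ≡ true → W a x) where

  open Acyclic T (proj₂ tree)

  Reach : Fin k → Fin N → Set
  Reach a v = ∃ λ z → W a z × Walk T (λ x → X a x ≡ false) v z

  W⊆Reach : ∀ {a x} → W a x → Reach a x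
  W⊆Reach {a} {x} w = x , w , here (W-avoids-X a x w)

  X-unreachable : ∀ {a x} → X a x ≡ true → ¬ Reach a x
  X-unreachable ax (_ , _ , p) with trans (sym ax) (walk-source p)
  ... | ()

  reach-walk : ∀ {a v z} → Walk T (λ x → X a x ≡ false) v z → W a z → Walk T (Reach a) v z
  reach-walk (here s)     w = here (_ , w , here s)
  reach-walk (step s e p) w = step (_ , w , step s e p) e (reach-walk p w)

  reach-connected : ∀ a → ConnectedOn T (Reach a)
  reach-connected a u v (z , wz , p) (z′ , wz′ , p′) =
    reach-walk p wz ◅◅ (map-walk W⊆Reach (W-connected a z z′ wz wz′) ◅◅ reverse-walk (reach-walk p′ wz′))

  boundary-edge : ∀ a → ¬ ¬ (Σ (Fin N) λ g → Σ (Fin N) λ w → ¬ Reach a g × Reach a w × Edge T g w)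
  boundary-edge a none with X-inhabited a | W-inhabited a
  ... | x , ax | w₀ , aw₀ = cross (X-unreachable ax) (proj₁ tree x w₀ tt tt)
    where
    cross : ∀ {u} → ¬ Reach a u → Walk T (λ _ → ⊤) u w₀ → ⊥
    cross u∉ (here _)     = u∉ (W⊆Reach aw₀)
    cross u∉ (step _ e p) = cross (λ r → none (_ , _ , u∉ , r , e)) p

  unreachable-leaf : ∀ a → ¬ ¬ (∃ λ v → degree T v ≡ 1 × ¬ Reach a v)
  unreachable-leaf a none =
    boundary-edge a λ (g , w , g∉ , w∈ , e) → none (leaf-outside (reach-connected a) g∉ w∈ e)

  unreachable-spreads : ∀ {c d u u′} → d ≢ c → ¬ Reach c u → ¬ Reach d u → Edge T u u′ → ¬ Reach c u′
  unreachable-spreads {c} {d} {u} d≢c cu du e (z , wz , p) with X c u in xu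
  ... | false = cu (z , wz , step xu e p)
  ... | true  = du (W⊆Reach (W-covers-X d c d≢c u xu))

  unreachable-disjoint : ∀ {a b v} → a ≢ b → ¬ Reach a v → ¬ Reach b v → ⊥
  unreachable-disjoint {a} {b} {v} a≢b av bv with W-inhabited a
  ... | y , ay = spread av bv (proj₁ tree v y tt tt)
    where
    spread : ∀ {u} → ¬ Reach a u → ¬ Reach b u → Walk T (λ _ → ⊤) u y → ⊥
    spread au bu (here _)     = au (W⊆Reach ay)
    spread au bu (step _ e p) =
      spread (unreachable-spreads (a≢b ∘ sym) au bu e) (unreachable-spreads a≢b bu au e) p

  -- Reach is not decidable, so the leaves are only found under double negation; the decidability
  -- of ≤ on ℕ removes it.
  k≤leafCount : k ≤ leafCount T
  k≤leafCount = decidable-stable (k ℕ.≤? leafCount T) λ k≰ →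
    sequence ¬¬-applicative unreachable-leaf λ leaf →
      k≰ (leaves-injection T (proj₁ ∘ leaf) (distinct leaf) (proj₁ ∘ proj₂ ∘ leaf))
    where
    ¬¬-applicative = RawMonad.rawApplicative ¬¬-Monad
    distinct : (leaf : ∀ a → ∃ λ v → degree T v ≡ 1 × ¬ Reach a v) → Injective _≡_ _≡_ (proj₁ ∘ leaf)
    distinct leaf {a} {b} same with a ≟ᶠ b
    ... | yes a≡b = a≡b
    ... | no  a≢b = ⊥-elim (unreachable-disjoint a≢b
                     (subst (¬_ ∘ Reach a) same (proj₂ (proj₂ (leaf a)))) (proj₂ (proj₂ (leaf b))))

module Representation {n t : ℕ} {G : Graph n} {T : Graph t} (rep : TreeRep G T) where

  S : Fin n → Fin t → Bool
  S = proj₁ rep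

  subtree : ∀ v → IsSubtree T (S v)
  subtree = proj₁ (proj₂ rep)

  meet : ∀ {u v} → u ≢ v → Edge G u v → ∃ λ x → S u x ≡ true × S v x ≡ true
  meet u≢v = Equivalence.to (proj₂ (proj₂ rep) _ _ u≢v)

  apart : ∀ {u v x} → u ≢ v → adj G u v ≡ false → S u x ≡ true → S v x ≡ true → ⊥
  apart u≢v uv ux vx with trans (sym uv) (Equivalence.from (proj₂ (proj₂ rep) _ _ u≢v) (_ , ux , vx))
  ... | ()

  Covered : (Fin n → Set) → Fin t → Set
  Covered R x = ∃ λ u → R u × S u x ≡ true

  covered-walk : ∀ {R u v x y} → Walk G R u v → S u x ≡ true → S v y ≡ true → Walk T (Covered R) x y
  covered-walk {u = u} {x = x} {y} (here r) ux uy =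
    map-walk (λ s → u , r , s) (proj₂ (subtree u) x y ux uy)
  covered-walk {u = u} {x = x} (step r e w) ux vy with meet (edge-irrefl G e) e
  ... | z , uz , vz = map-walk (λ s → u , r , s) (proj₂ (subtree u) x z ux uz) ◅◅ covered-walk w vz vy

  covered-connected : ∀ {R} → ConnectedOn G R → ConnectedOn T (Covered R)
  covered-connected connected x y (u , ru , ux) (v , rv , vy) = covered-walk (connected u v ru rv) ux vy

-- region a witnesses that the points other than point a lie in one component of G minus the closed
-- neighbourhood of point a.
record Asteroidal {n : ℕ} (G : Graph n) (k : ℕ) : Set₁ where
  field
    point     : Fin k → Fin n
    region    : Fin k → Fin n → Set
    inhabited : ∀ a → ∃ (region a)
    connected : ∀ a → ConnectedOn G (region a)
    avoids    : ∀ a u → region a u → point a ≢ u × adj G (point a) u ≡ false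
    contains  : ∀ a b → a ≢ b → region a (point b)

asteroidal⇒leaves : ∀ {n t k} {G : Graph n} {T : Graph t} → IsTree T → TreeRep G T → Asteroidal G k →
                    k ≤ leafCount T
asteroidal⇒leaves {T = T} tree rep A =
  PrivateLeaves.k≤leafCount T tree (S ∘ point) (Covered ∘ region)
    (λ a → proj₁ (subtree (point a)))
    (λ a → let u , ru = inhabited a ; x , ux = proj₁ (subtree u) in x , u , ru , ux)
    (λ a → covered-connected (connected a))
    avoids-X
    (λ a b a≢b x bx → point b , contains a b a≢b , bx)
  where
  open Representation rep
  open Asteroidal A
  avoids-X : ∀ a x → Covered (region a) x → S (point a) x ≡ false
  avoids-X a x (u , ru , ux) with S (point a) x in ax
  ... | false = refl
  ... | true  = ⊥-elim (apart (proj₁ (avoids a u ru)) (proj₂ (avoids a u ru)) ax ux)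

asteroidal⇒¬leafage : ∀ {n ℓ} {G : Graph n} → Asteroidal G (suc ℓ) → ¬ LeafageAtMost ℓ G
asteroidal⇒¬leafage A (_ , T , tree , rep , leaves) = ℕ.<⇒≱ (s≤s leaves) (asteroidal⇒leaves tree rep A)

module InducedH {n k : ℕ} (G : Graph n) (embedding : Embeds (hAdj (2 + k)) G) where

  m : ℕ
  m = 2 + k

  f : Fin (m + m) → Fin n
  f = proj₁ embedding

  clique indep : Fin m → Fin (m + m)
  clique a = a ↑ˡ m
  indep  a = m ↑ʳ a

  hAdj-clique-clique : ∀ a b → hAdj m (clique a) (clique b) ≡ true
  hAdj-clique-clique a b rewrite splitAt-↑ˡ m a m | splitAt-↑ˡ m b m = refl

  hAdj-indep-clique : ∀ a b → hAdj m (indep a) (clique b) ≡ does (a ≟ᶠ b)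
  hAdj-indep-clique a b rewrite splitAt-↑ʳ m m a | splitAt-↑ˡ m b m = refl

  hAdj-indep-indep : ∀ a b → hAdj m (indep a) (indep b) ≡ false
  hAdj-indep-indep a b rewrite splitAt-↑ʳ m m a | splitAt-↑ʳ m m b = refl

  indep≢clique : ∀ a b → indep a ≢ clique b
  indep≢clique a b eq with trans (sym (splitAt-↑ʳ m m a)) (trans (cong (splitAt m) eq) (splitAt-↑ˡ m b m))
  ... | ()

  adj-image : ∀ {i j} → i ≢ j → adj G (f i) (f j) ≡ hAdj m i j
  adj-image i≢j = sym (proj₂ (proj₂ embedding) _ _ i≢j)

  f-distinct : ∀ {i j} → i ≢ j → f i ≢ f j
  f-distinct i≢j = i≢j ∘ proj₁ (proj₂ embedding)

  Region : Fin m → Fin n → Set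
  Region a u = Σ (Fin m) λ b → b ≢ a × (u ≡ f (clique b) ⊎ u ≡ f (indep b))

  to-clique : ∀ {a u} ((b , b≢a , _) : Region a u) → Walk G (Region a) u (f (clique b))
  to-clique (b , b≢a , inj₁ refl) = here (b , b≢a , inj₁ refl)
  to-clique (b , b≢a , inj₂ refl) =
    step (b , b≢a , inj₂ refl)
      (trans (adj-image (indep≢clique b b)) (trans (hAdj-indep-clique b b) (dec-true (b ≟ᶠ b) refl)))
      (here (b , b≢a , inj₁ refl))

  clique-walk : ∀ {a b c} → b ≢ a → c ≢ a → Walk G (Region a) (f (clique b)) (f (clique c))
  clique-walk {a} {b} {c} b≢a c≢a with b ≟ᶠ c
  ... | yes refl = here (b , b≢a , inj₁ refl)
  ... | no b≢c   = step (b , b≢a , inj₁ refl)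
                     (trans (adj-image (b≢c ∘ ↑ˡ-injective m b c)) (hAdj-clique-clique b c))
                     (here (c , c≢a , inj₁ refl))

  other : Fin m → Fin m
  other zero    = suc zero
  other (suc _) = zero

  other≢ : ∀ a → other a ≢ a
  other≢ zero    ()
  other≢ (suc _) ()

  avoids : ∀ a u → Region a u → f (indep a) ≢ u × adj G (f (indep a)) u ≡ false
  avoids a u (b , b≢a , inj₁ refl) =
    f-distinct (indep≢clique a b) ,
    trans (adj-image (indep≢clique a b)) (trans (hAdj-indep-clique a b) (dec-false (a ≟ᶠ b) (b≢a ∘ sym)))
  avoids a u (b , b≢a , inj₂ refl) =
    f-distinct (b≢a ∘ sym ∘ ↑ʳ-injective m a b) ,
    trans (adj-image (b≢a ∘ sym ∘ ↑ʳ-injective m a b)) (hAdj-indep-indep a b)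

  asteroidal : Asteroidal G m
  asteroidal = record
    { point     = f ∘ indep
    ; region    = Region
    ; inhabited = λ a → f (clique (other a)) , other a , other≢ a , inj₁ refl
    ; connected = λ a u v ru rv →
        to-clique ru ◅◅ (clique-walk (proj₁ (proj₂ ru)) (proj₁ (proj₂ rv)) ◅◅ reverse-walk (to-clique rv))
    ; avoids    = avoids
    ; contains  = λ a b a≢b → b , a≢b ∘ sym , inj₂ refl
    }

TriangleFree : ∀ {n} → Graph n → Set
TriangleFree G = ∀ x y z → Edge G x y → Edge G y z → Edge G x z → ⊥

triangle-free⇒¬H : ∀ {n k} {G : Graph n} → TriangleFree G → ¬ Embeds (hAdj (3 + k)) G
triangle-free⇒¬H free (f , _ , pres) =
  free _ _ _ (sym (pres zero (suc zero) λ ())) (sym (pres (suc zero) (suc (suc zero)) λ ()))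
       (sym (pres zero (suc (suc zero)) λ ()))

NoNonBacktrackingWalk₅ : ∀ {n} → Graph n → Set
NoNonBacktrackingWalk₅ G = ∀ {v₀ v₁ v₂ v₃ v₄ v₅} →
  Edge G v₀ v₁ → Edge G v₁ v₂ → Edge G v₂ v₃ → Edge G v₃ v₄ → Edge G v₄ v₅ →
  v₀ ≢ v₂ → v₁ ≢ v₃ → v₂ ≢ v₄ → v₃ ≢ v₅ → ⊥

cycAdj-wrap : ∀ r → cycAdj (4 + r) zero (fromℕ (3 + r)) ≡ true
cycAdj-wrap r rewrite toℕ-fromℕ r | dec-true (r ≟ r) refl = refl

no-nonbacktracking-walk₅⇒chordal : ∀ {n} {G : Graph n} → NoNonBacktrackingWalk₅ G → Chordal G
no-nonbacktracking-walk₅⇒chordal {G = G} none r (g , g-inj , pres) =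
  none (edge-sym G (edge zero (fromℕ (3 + r)) (λ ()) (cycAdj-wrap r)))
       (edge zero (suc zero) (λ ()) refl) (edge (suc zero) (suc (suc zero)) (λ ()) refl)
       (edge (suc (suc zero)) (suc (suc (suc zero))) (λ ()) refl)
       (edge (suc (suc (suc zero))) (after r) (3≢after r) (3→after r))
       (distinct λ ()) (distinct λ ()) (distinct λ ()) (distinct (2≢after r))
  where
  edge : ∀ i j → i ≢ j → cycAdj (4 + r) i j ≡ true → Edge G (g i) (g j)
  edge i j i≢j h = trans (sym (pres i j i≢j)) h
  distinct : ∀ {i j} → i ≢ j → g i ≢ g j
  distinct i≢j = i≢j ∘ g-inj
  after : ∀ r → Fin (4 + r)
  after zero    = zero
  after (suc r) = suc (suc (suc (suc zero)))
  3→after : ∀ r → cycAdj (4 + r) (suc (suc (suc zero))) (after r) ≡ true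
  3→after zero    = refl
  3→after (suc r) = refl
  3≢after : ∀ r → suc (suc (suc zero)) ≢ after r
  3≢after zero    ()
  3≢after (suc r) ()
  2≢after : ∀ r → suc (suc zero) ≢ after r
  2≢after zero    ()
  2≢after (suc r) ()

does-sym : ∀ {m} (i j : Fin m) → does (i ≟ᶠ j) ≡ does (j ≟ᶠ i)
does-sym i j with i ≟ᶠ j | j ≟ᶠ i
... | yes _   | yes _   = refl
... | no _    | no _    = refl
... | yes i≡j | no j≢i  = ⊥-elim (j≢i (sym i≡j))
... | no i≢j  | yes j≡i = ⊥-elim (i≢j (sym j≡i))

module Spider (m : ℕ) where

  data Vertex : Set where
    centre   : Vertex
    arm tip  : Fin m → Vertex

  vadj : Vertex → Vertex → Bool
  vadj centre  (arm _) = true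
  vadj (arm _) centre  = true
  vadj (arm i) (tip j) = does (i ≟ᶠ j)
  vadj (tip i) (arm j) = does (i ≟ᶠ j)
  vadj _       _       = false

  vadj-sym : ∀ v w → vadj v w ≡ vadj w v
  vadj-sym centre  centre  = refl
  vadj-sym centre  (arm _) = refl
  vadj-sym centre  (tip _) = refl
  vadj-sym (arm _) centre  = refl
  vadj-sym (arm _) (arm _) = refl
  vadj-sym (arm i) (tip j) = does-sym i j
  vadj-sym (tip _) centre  = refl
  vadj-sym (tip i) (arm j) = does-sym i j
  vadj-sym (tip _) (tip _) = refl

  vadj-irrefl : ∀ v → vadj v v ≡ false
  vadj-irrefl centre  = refl
  vadj-irrefl (arm _) = refl
  vadj-irrefl (tip _) = refl

  N : ℕ
  N = suc (m + m)

  decode : Fin N → Vertex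
  decode zero    = centre
  decode (suc x) = [ arm , tip ]′ (splitAt m x)

  encode : Vertex → Fin N
  encode centre  = zero
  encode (arm i) = suc (i ↑ˡ m)
  encode (tip i) = suc (m ↑ʳ i)

  decode-encode : ∀ v → decode (encode v) ≡ v
  decode-encode centre  = refl
  decode-encode (arm i) rewrite splitAt-↑ˡ m i m = refl
  decode-encode (tip i) rewrite splitAt-↑ʳ m m i = refl

  encode-decode : ∀ x → encode (decode x) ≡ x
  encode-decode zero    = refl
  encode-decode (suc x) = trans (encode-[,] (splitAt m x)) (cong suc (join-splitAt m m x))
    where
    encode-[,] : ∀ s → encode ([ arm , tip ]′ s) ≡ suc (join m m s)
    encode-[,] (inj₁ _) = refl
    encode-[,] (inj₂ _) = refl

  decode-injective : ∀ {x y} → decode x ≡ decode y → x ≡ y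
  decode-injective {x} {y} eq = trans (sym (encode-decode x)) (trans (cong encode eq) (encode-decode y))

  encode-injective : ∀ {v w} → encode v ≡ encode w → v ≡ w
  encode-injective {v} {w} eq = trans (sym (decode-encode v)) (trans (cong decode eq) (decode-encode w))

  spider : Graph N
  spider = record
    { adj    = λ x y → vadj (decode x) (decode y)
    ; sym    = λ x y → vadj-sym (decode x) (decode y)
    ; irrefl = λ x → vadj-irrefl (decode x)
    }

  adj-encode : ∀ v w → adj spider (encode v) (encode w) ≡ vadj v w
  adj-encode v w rewrite decode-encode v | decode-encode w = refl

  tip-neighbour : ∀ {i v} → vadj (tip i) v ≡ true → v ≡ arm i
  tip-neighbour {i} {arm j} e with i ≟ᶠ j
  ... | yes refl = refl

  arm-neighbour : ∀ {i v} → vadj (arm i) v ≡ true → v ≡ centre ⊎ v ≡ tip i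
  arm-neighbour {v = centre} _ = inj₁ refl
  arm-neighbour {i} {tip j} e with i ≟ᶠ j
  ... | yes refl = inj₂ refl

  centre-neighbour : ∀ {v} → vadj centre v ≡ true → ∃ λ j → v ≡ arm j
  centre-neighbour {arm j} _ = j , refl

  vadj-flip : ∀ v w → vadj v w ≡ true → vadj w v ≡ true
  vadj-flip v w e = trans (vadj-sym w v) e

  vertex-no-walk₅ : ∀ {v₀ v₁ v₂ v₃ v₄ v₅} →
    vadj v₀ v₁ ≡ true → vadj v₁ v₂ ≡ true → vadj v₂ v₃ ≡ true → vadj v₃ v₄ ≡ true → vadj v₄ v₅ ≡ true →
    v₀ ≢ v₂ → v₁ ≢ v₃ → v₂ ≢ v₄ → v₃ ≢ v₅ → ⊥
  vertex-no-walk₅ {v₀} {v₁} {tip i} {v₃} e₀₁ e₁₂ e₂₃ e₃₄ e₄₅ n₀₂ n₁₃ n₂₄ n₃₅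
    with tip-neighbour {i} {v₁} (vadj-flip v₁ (tip i) e₁₂) | tip-neighbour {i} {v₃} e₂₃
  ... | refl | refl = n₁₃ refl
  vertex-no-walk₅ {v₀} {v₁} {arm i} {v₃} {v₄} e₀₁ e₁₂ e₂₃ e₃₄ e₄₅ n₀₂ n₁₃ n₂₄ n₃₅
    with arm-neighbour {i} {v₁} (vadj-flip v₁ (arm i) e₁₂) | arm-neighbour {i} {v₃} e₂₃
  ... | inj₁ refl | inj₁ refl = n₁₃ refl
  ... | inj₂ refl | _         = n₀₂ (tip-neighbour {i} {v₀} (vadj-flip v₀ (tip i) e₀₁))
  ... | inj₁ refl | inj₂ refl = n₂₄ (sym (tip-neighbour {i} {v₄} e₃₄))
  vertex-no-walk₅ {v₂ = centre} {v₃} {v₄} {v₅} e₀₁ e₁₂ e₂₃ e₃₄ e₄₅ n₀₂ n₁₃ n₂₄ n₃₅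
    with centre-neighbour {v₃} e₂₃
  ... | j , refl with arm-neighbour {j} {v₄} e₃₄
  ...   | inj₁ refl = n₂₄ refl
  ...   | inj₂ refl = n₃₅ (sym (tip-neighbour {j} {v₅} e₄₅))

  spider-no-walk₅ : NoNonBacktrackingWalk₅ spider
  spider-no-walk₅ e₀₁ e₁₂ e₂₃ e₃₄ e₄₅ n₀₂ n₁₃ n₂₄ n₃₅ =
    vertex-no-walk₅ e₀₁ e₁₂ e₂₃ e₃₄ e₄₅
      (n₀₂ ∘ decode-injective) (n₁₃ ∘ decode-injective) (n₂₄ ∘ decode-injective) (n₃₅ ∘ decode-injective)

  side : Vertex → Bool
  side centre  = true
  side (arm _) = false
  side (tip _) = true

  vadj-bipartite : ∀ v w → vadj v w ≡ true → side v ≡ not (side w)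
  vadj-bipartite centre  (arm _) _ = refl
  vadj-bipartite (arm _) centre  _ = refl
  vadj-bipartite (arm _) (tip _) _ = refl
  vadj-bipartite (tip _) (arm _) _ = refl

  spider-triangle-free : TriangleFree spider
  spider-triangle-free x y z xy yz xz = not-¬ refl (trans (sym xz′) (trans xy′ (cong not yz′)))
    where
    xy′ = vadj-bipartite (decode x) (decode y) xy
    yz′ = vadj-bipartite (decode y) (decode z) yz
    xz′ = vadj-bipartite (decode x) (decode z) xz

  data OffLeg (a : Fin m) : Vertex → Set where
    centre : OffLeg a centre
    arm    : ∀ {j} → j ≢ a → OffLeg a (arm j)
    tip    : ∀ {j} → j ≢ a → OffLeg a (tip j)

  Region : Fin m → Fin N → Set
  Region a x = Σ Vertex λ v → OffLeg a v × x ≡ encode v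

  to-centre : ∀ {a v} → OffLeg a v → Walk spider (Region a) (encode v) (encode centre)
  to-centre centre = here (centre , centre , refl)
  to-centre {v = arm j} (arm j≢a) =
    step (arm j , arm j≢a , refl) (adj-encode (arm j) centre) (to-centre centre)
  to-centre {v = tip j} (tip j≢a) =
    step (tip j , tip j≢a , refl) (trans (adj-encode (tip j) (arm j)) (dec-true (j ≟ᶠ j) refl))
      (step (arm j , arm j≢a , refl) (adj-encode (arm j) centre) (to-centre centre))

  tip-nonadjacent : ∀ {a v} → OffLeg a v → vadj (tip a) v ≡ false
  tip-nonadjacent centre           = refl
  tip-nonadjacent {a} (arm {j} j≢a) = dec-false (a ≟ᶠ j) (j≢a ∘ sym)
  tip-nonadjacent (tip _)          = refl

  tip-off-leg : ∀ {a v} → OffLeg a v → tip a ≢ v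
  tip-off-leg (tip j≢a) refl = j≢a refl

  spider-asteroidal : Asteroidal spider m
  spider-asteroidal = record
    { point     = encode ∘ tip
    ; region    = Region
    ; inhabited = λ a → encode centre , centre , centre , refl
    ; connected = λ { a _ _ (_ , off , refl) (_ , off′ , refl) →
                      to-centre off ◅◅ reverse-walk (to-centre off′) }
    ; avoids    = λ { a _ (v , off , refl) →
                      tip-off-leg off ∘ encode-injective ,
                      trans (adj-encode (tip a) v) (tip-nonadjacent off) }
    ; contains  = λ a b a≢b → tip b , tip (a≢b ∘ sym) , refl
    }

mainTheorem6 : (ℓ : ℕ) → 2 ≤ ℓ →
    ((n : ℕ) (G : Graph n) → Chordal G → LeafageAtMost ℓ G →
        Chordal G × ¬ Embeds (hAdj (suc ℓ)) G)
    × Σ ℕ (λ n → Σ (Graph n) (λ G →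
        Chordal G × ¬ Embeds (hAdj (suc ℓ)) G × ¬ LeafageAtMost ℓ G))
mainTheorem6 (suc (suc ℓ)) (s≤s (s≤s z≤n)) =
  (λ n G chordal leafage →
     chordal , λ H⊆G → asteroidal⇒¬leafage (InducedH.asteroidal {k = suc ℓ} G H⊆G) leafage) ,
  (_ , spider , no-nonbacktracking-walk₅⇒chordal {G = spider} spider-no-walk₅ ,
   triangle-free⇒¬H {k = ℓ} {G = spider} spider-triangle-free , asteroidal⇒¬leafage spider-asteroidal)
  where open Spider (3 + ℓ)
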